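{- Let $n>2$ be finite. For any graph $\Gamma$, the algebra $\mathfrak B(\Gamma)$ is a simple polyadic equality algebra of dimension $n$.
   Context: A graph is $\Gamma=(G,E)$ with $E$ reflexive and symmetric; $X\subseteq G$ is independent if $E\cap(X\times X)=\emptyset$. Define $\eta(\Gamma)$ as the set of pairs $(K,\sim)$ with $K:n\to\Gamma\times n$ a partial map and $\sim$ an equivalence relation on $n$ such that: if $|n/\sim|=n$ then $\mathrm{dom}(K)=n$ and $\mathrm{rng}(K)$ is not independent (as a subset of $\Gamma\times n$, with the graph structure induced from $\Gamma$ on first coordinates); if $|n/\sim|=n-1$ then $K$ is defined exactly on the unique $\sim$-class $\{i,j\}$ of size $2$ and $K(i)=K(j)$; if $|n/\sim|\le n-2$ then $K$ is nowhere defined. Here "$K(i)=K(j)$" means both undefined or both defined and equal. Put $D_{ij}=\{(K,\sim):i\sim j\}$; $(K,\sim)\equiv_i(K',\sim')$ iff $K(i)=K'(i)$ and $\sim$ and $\sim'$ agree on $n\setminus\{i\}$; $(K,\sim)\equiv_{ij}(K',\sim')$ iff $K(i)=K'(j)$, $K(j)=K'(i)$, $K(k)=K'(k)$ for $k\notin\{i,j\}$, and $\sim'=\sim$ if $i\sim j$, otherwise $\sim'=\sim\circ[i,j]$. $\mathfrak B(\Gamma)$ is the power set of $\eta(\Gamma)$ with Boolean set operations and ${\sf d}_{ij}=D_{ij}$, ${\sf c}_iX=\{c:\exists a\in X,\ a\equiv_ic\}$, ${\sf s}_{ij}X=\{c:\exists a\in X,\ a\equiv_{ij}c\}$, ${\sf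 s}^i_jX={\sf c}_i(X\cap D_{ij})$ for $i\ne j$ and ${\sf s}^i_iX=X$. Polyadic equality algebras of dimension $n$ are Boolean algebras with operations ${\sf c}_i,{\sf d}_{ij},{\sf s}^i_j,{\sf s}_{ij}$ satisfying the standard axioms; simple means having no nontrivial proper ideals. -}

module Defs where

open import Level using (Level; _⊔_) renaming (suc to lsuc)
open import Data.Nat using (ℕ; zero; suc; _∸_; _≤_)
open import Data.Fin using (Fin; _<?_)
open import Data.Fin.Properties using (_≟_)
open import Data.Bool using (Bool; true; false; not; if_then_else_)
open import Data.Maybe using (Maybe; just; nothing; Is-just)
open import Data.List using (List; allFin; filter; map)
open import Data.Bool.ListAction using (all)
open import Data.Nat.ListAction using (sum)
open import Data.Product using (Σ; ∃; _×_; _,_; proj₁; proj₂)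
open import Data.Sum using (_⊎_)
open import Data.Empty using (⊥)
open import Data.Unit using (⊤)
open import Relation.Nullary using (¬_; yes; no)
open import Relation.Binary.PropositionalEquality using (_≡_; _≢_; refl; sym; trans)
open import Algebra.Lattice.Structures using (IsBooleanAlgebra)

-- Abstract part: the signature and axioms of polyadic equality algebras
-- of dimension n (Sain–Thompson axioms (Q0)–(Q11)), and simplicity.

record PEASig (n : ℕ) {a : Level} (A : Set a) : Set a where
  field
    _+_ _·_ : A → A → A
    -_      : A → A
    𝟘 𝟙     : A
    c       : Fin n → A → A
    d       : Fin n → Fin n → A
    s[_/_]  : Fin n → Fin n → A → A
    s       : Fin n → Fin n → A → A -- s i j = s_ij (transposition)

module _ {n : ℕ} {a ℓ : Level} {A : Set a} (_≈_ : A → A → Set ℓ) (𝔄 : PEASig n A) where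
  open PEASig 𝔄

  _≤ᴮ_ : A → A → Set ℓ
  x ≤ᴮ y = (x · y) ≈ x

  record IsBoolEndo (f : A → A) : Set (a ⊔ ℓ) where
    field
      pres-+ : ∀ x y → f (x + y) ≈ (f x + f y)
      pres-· : ∀ x y → f (x · y) ≈ (f x · f y)
      pres-- : ∀ x → f (- x) ≈ (- f x)
      pres-𝟘 : f 𝟘 ≈ 𝟘
      pres-𝟙 : f 𝟙 ≈ 𝟙

  record IsPEA : Set (a ⊔ ℓ) where
    field
      isBooleanAlgebra : IsBooleanAlgebra _≈_ _+_ _·_ -_ 𝟙 𝟘
      c-cong   : ∀ i {x y} → x ≈ y → c i x ≈ c i y
      sub-cong : ∀ i j {x y} → x ≈ y → s[ i / j ] x ≈ s[ i / j ] y
      s-cong   : ∀ i j {x y} → x ≈ y → s i j x ≈ s i j y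
      d-ii     : ∀ i → d i i ≈ 𝟙
      sub-ii   : ∀ i x → s[ i / i ] x ≈ x
      s-ii     : ∀ i x → s i i x ≈ x
      s-comm   : ∀ i j x → s i j x ≈ s j i x
      Q1 : ∀ i x → x ≤ᴮ c i x
      Q2 : ∀ i x y → c i (x + y) ≈ (c i x + c i y)
      Q3 : ∀ i j x → s[ i / j ] (c i x) ≈ c i x
      Q4 : ∀ i j x → i ≢ j → c i (s[ i / j ] x) ≈ s[ i / j ] x
      Q5 : ∀ i j k m x → i ≢ k → i ≢ m → j ≢ k → j ≢ m →
           s[ i / j ] (s[ k / m ] x) ≈ s[ k / m ] (s[ i / j ] x)
      Q6-sub : ∀ i j → IsBoolEndo s[ i / j ]
      Q6-s   : ∀ i j → IsBoolEndo (s i j)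
      Q7 : ∀ i j x → s i j (s i j x) ≈ x
      Q8 : ∀ i j k x → i ≢ j → j ≢ k → i ≢ k → s i j (s i k x) ≈ s j k (s i j x)
      Q9 : ∀ i j x → s i j (s[ i / j ] x) ≈ s[ j / i ] x
      Q10 : ∀ i j → s[ i / j ] (d i j) ≈ 𝟙
      Q11 : ∀ i j x → (x · d i j) ≤ᴮ s[ i / j ] x

  record IsIdeal (I : A → Set a) : Set (a ⊔ ℓ) where
    field
      has-𝟘   : I 𝟘
      +-closed : ∀ {x y} → I x → I y → I (x + y)
      ↓-closed : ∀ {x y} → I y → x ≤ᴮ y → I x
      c-closed : ∀ i {x} → I x → I (c i x)

  IsSimple : Set (lsuc a ⊔ ℓ)
  IsSimple = ∀ (I : A → Set a) → IsIdeal I →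
             (∀ x → I x → x ≈ 𝟘) ⊎ (∀ x → I x)

record Graph : Set₁ where
  field
    V     : Set
    E     : V → V → Set
    E-refl : ∀ g → E g g
    E-sym  : ∀ {g h} → E g h → E h g

_×ᴳ_ : Graph → ℕ → Graph
Γ ×ᴳ n = record
  { V = V × Fin n
  ; E = λ x y → E (proj₁ x) (proj₁ y)
  ; E-refl = λ x → E-refl (proj₁ x)
  ; E-sym = E-sym }
  where open Graph Γ

Independent : (Γ : Graph) → (Graph.V Γ → Set) → Set
Independent Γ X = ∀ x y → X x → X y → ¬ Graph.E Γ x y

record IsEquivB {n : ℕ} (R : Fin n → Fin n → Bool) : Set where
  field
    R-refl  : ∀ i → R i i ≡ true
    R-sym   : ∀ {i j} → R i j ≡ true → R j i ≡ true
    R-trans : ∀ {i j k} → R i j ≡ true → R j k ≡ true → R i k ≡ true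

isLeast : {n : ℕ} → (Fin n → Fin n → Bool) → Fin n → Bool
isLeast {n} R i = all (λ j → not (R i j)) (filter (_<? i) (allFin n))

-- |n/∼| : number of equivalence classes (= number of least representatives)
numClasses : {n : ℕ} → (Fin n → Fin n → Bool) → ℕ
numClasses {n} R = sum (map (λ i → if isLeast R i then 1 else 0) (allFin n))

transp : {n : ℕ} → Fin n → Fin n → Fin n → Fin n
transp i j k with k ≟ i
... | yes _ = j
... | no _ with k ≟ j
...   | yes _ = i
...   | no _ = k

module _ (n : ℕ) (Γ : Graph) where
  open Graph Γ

  Rng : (Fin n → Maybe (V × Fin n)) → V × Fin n → Set
  Rng K v = ∃ λ i → K i ≡ just v

  record η : Set where
    field
      K       : Fin n → Maybe (V × Fin n)
      R       : Fin n → Fin n → Bool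
      R-equiv : IsEquivB R
      cond-n   : numClasses R ≡ n →
                 (∀ i → Is-just (K i)) × ¬ Independent (Γ ×ᴳ n) (Rng K)
      cond-n-1 : numClasses R ≡ n ∸ 1 → ∀ i j → i ≢ j → R i j ≡ true →
                 (∀ k → (Is-just (K k) → (k ≡ i ⊎ k ≡ j)) × ((k ≡ i ⊎ k ≡ j) → Is-just (K k)))
                 × K i ≡ K j
      cond-n-2 : numClasses R ≤ n ∸ 2 → ∀ k → K k ≡ nothing
  open η public

  -- identity of elements of η(Γ) (ignoring the proof components)
  _≋_ : η → η → Set
  a ≋ b = (∀ i → K a i ≡ K b i) × (∀ i j → R a i j ≡ R b i j)

  ≋-sym : ∀ {a b : η} → a ≋ b → b ≋ a
  ≋-sym (p , q) = (λ i → sym (p i)) , (λ i j → sym (q i j))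

  _≡[_]_ : η → Fin n → η → Set
  a ≡[ i ] b = K a i ≡ K b i × (∀ j k → j ≢ i → k ≢ i → R a j k ≡ R b j k)

  _≡[_∣_]_ : η → Fin n → Fin n → η → Set
  a ≡[ i ∣ j ] b =
    K a i ≡ K b j × K a j ≡ K b i × (∀ k → k ≢ i → k ≢ j → K a k ≡ K b k) ×
    (∀ k l → R b k l ≡ (if R a i j then R a k l else R a (transp i j k) (transp i j l)))

  record Sub : Set₁ where
    field
      _∋_  : η → Set
      ∋-resp : ∀ {a b} → a ≋ b → _∋_ a → _∋_ b
  open Sub public

  _≈𝔅_ : Sub → Sub → Set
  X ≈𝔅 Y = ∀ a → (X ∋ a → Y ∋ a) × (Y ∋ a → X ∋ a)

  _∪_ : Sub → Sub → Sub
  X ∪ Y = record { _∋_ = λ a → X ∋ a ⊎ Y ∋ a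
                 ; ∋-resp = λ { e (Data.Sum.inj₁ x) → Data.Sum.inj₁ (∋-resp X e x)
                            ; e (Data.Sum.inj₂ y) → Data.Sum.inj₂ (∋-resp Y e y) } }

  _∩_ : Sub → Sub → Sub
  X ∩ Y = record { _∋_ = λ a → X ∋ a × Y ∋ a
                 ; ∋-resp = λ e (x , y) → ∋-resp X e x , ∋-resp Y e y }

  ∁ : Sub → Sub
  ∁ X = record { _∋_ = λ a → ¬ (X ∋ a)
               ; ∋-resp = λ {a} {b} e nx x → nx (∋-resp X (≋-sym {a} {b} e) x) }

  ∅ : Sub
  ∅ = record { _∋_ = λ _ → ⊥ ; ∋-resp = λ _ () }

  Full : Sub
  Full = record { _∋_ = λ _ → ⊤ ; ∋-resp = λ _ t → t }

  D : Fin n → Fin n → Sub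
  D i j = record { _∋_ = λ a → R a i j ≡ true
                 ; ∋-resp = λ e p → trans (sym (proj₂ e i j)) p }

  C : Fin n → Sub → Sub
  C i X = record
    { _∋_ = λ c → ∃ λ a → X ∋ a × a ≡[ i ] c
    ; ∋-resp = λ { (eK , eR) (a , x , p , q) →
        a , x , trans p (eK i) , λ j k j≢ k≢ → trans (q j k j≢ k≢) (eR j k) } }

  S : Fin n → Fin n → Sub → Sub
  S i j X = record
    { _∋_ = λ c → ∃ λ a → X ∋ a × a ≡[ i ∣ j ] c
    ; ∋-resp = λ { (eK , eR) (a , x , p₁ , p₂ , p₃ , p₄) →
        a , x , trans p₁ (eK j) , trans p₂ (eK i) ,
        (λ k k≢i k≢j → trans (p₃ k k≢i k≢j) (eK k)) ,
        (λ k l → trans (sym (eR k l)) (p₄ k l)) } }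

  Subst : Fin n → Fin n → Sub → Sub
  Subst i j X with i ≟ j
  ... | yes _ = X
  ... | no _  = C i (X ∩ D i j)

  𝔅 : PEASig n Sub
  𝔅 = record
    { _+_ = _∪_ ; _·_ = _∩_ ; -_ = ∁ ; 𝟘 = ∅ ; 𝟙 = Full
    ; c = C ; d = D ; s[_/_] = Subst ; s = S }

{-# OPTIONS --safe #-}
module Submission where

-- Both kinds of substitution in 𝔅(Γ) are inverse images of maps on atoms. For s_ij this is
-- a ↦ a∘[i,j]. For s^i_j with i ≠ j, the element c_i(X · d_ij) consists of the atoms a whose
-- "identification" a[i/j] lies in X, where a[i/j] is the unique atom that agrees with a off i
-- and relates i to j: its relation is ∼ pulled back along i ↦ j, and its map K is K(i) on
-- {i, j} and undefined elsewhere. The conditions of η only depend on whether ∼ is discrete,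
-- has exactly one related pair, or has more, and this makes admissibility and uniqueness of
-- a[i/j] a case analysis. Inverse images are Boolean endomorphisms, so (Q6) is automatic and
-- the other substitution axioms become identities between these atom maps.
--
-- For simplicity, identifying 1, 2, …, n−1 in turn with 0 joins any atom, by a chain of
-- ≡_1, …, ≡_{n−1} steps, to an atom in which all indices are related. That atom is unique,
-- because with n ≥ 3 there are two related pairs and so K is nowhere defined. Hence
-- cylindrifying a nonzero element along 1, …, n−1 and then back along n−1, …, 1 gives the
-- unit.

open import Defs
open import Data.Nat using (ℕ; _<_)
open import Data.Product using (_×_)
open import Axiom.ExcludedMiddle using (ExcludedMiddle)

open import Level using (0ℓ) renaming (suc to lsuc)
open import Function using (_∘_; id; _⇔_; mk⇔; Equivalence)
import Function.Properties.Equivalence as ⇔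
open import Data.Nat as ℕ using (zero; suc; _∸_; _≤_; z≤n; s≤s)
import Data.Nat.Properties as ℕ
open import Data.Nat.ListAction using (sum)
open import Data.Fin as Fin using (Fin; zero; suc; _<?_)
open import Data.Fin.Properties using (_≟_; <-cmp; suc-injective)
open import Data.Bool using (Bool; true; false; if_then_else_)
open import Data.Bool.Properties using (T-≡; T-not-≡)
open import Data.Maybe using (Maybe; just; nothing; Is-just)
import Data.Maybe.Relation.Unary.Any as Any
open import Data.List using (List; []; _∷_; _++_; reverse; allFin; tabulate; map; filter)
open import Data.List.Properties using (map-tabulate; unfold-reverse)
open import Data.List.Relation.Unary.All as All using (All; []; _∷_)
open import Data.List.Relation.Unary.All.Properties using (all⁺; all⁻; tabulate⁺)
open import Data.List.Relation.Unary.Any using (here; there)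
open import Data.List.Membership.Propositional using (_∈_)
open import Data.List.Membership.Propositional.Properties
  using (∈-filter⁺; ∈-filter⁻; ∈-allFin; ∈-tabulate⁺)
open import Data.Product using (∃; ∃₂; _,_; proj₁; proj₂)
open import Data.Sum as Sum using (_⊎_; inj₁; inj₂; [_,_]′)
open import Data.Empty using (⊥-elim)
open import Data.Unit using (tt)
open import Relation.Nullary using (¬_; Dec; yes; no; decidable-stable)
open import Relation.Binary using (IsEquivalence; tri<; tri≈; tri>)
open import Relation.Binary.PropositionalEquality
open import Relation.Unary using (Pred; _≐_)
import Relation.Unary.Algebra as Pred
open import Algebra.Lattice.Structures using (IsBooleanAlgebra)

open Equivalence using (to; from)

true≢false : true ≢ false
true≢false ()

if-redundant : ∀ c {x y : Bool} → (c ≡ true → x ≡ y) → (if c then x else y) ≡ y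
if-redundant true  x≡y = x≡y refl
if-redundant false _   = refl

≡nothing⇒¬Is-just : ∀ {A : Set} {x : Maybe A} → x ≡ nothing → ¬ Is-just x
≡nothing⇒¬Is-just refl ()

¬Is-just⇒≡nothing : ∀ {A : Set} {x : Maybe A} → ¬ Is-just x → x ≡ nothing
¬Is-just⇒≡nothing {x = just _}  ¬just = ⊥-elim (¬just (Any.just _))
¬Is-just⇒≡nothing {x = nothing} _     = refl

count : ∀ {n} → (Fin n → Bool) → ℕ
count {zero}  P = 0
count {suc n} P = (if P zero then 1 else 0) ℕ.+ count (P ∘ suc)

module _ {n : ℕ} where

  numClasses≡count : (R : Fin n → Fin n → Bool) → numClasses R ≡ count (isLeast R)
  numClasses≡count R =
    trans (cong sum (map-tabulate {n = n} id (λ i → if isLeast R i then 1 else 0))) (sum-tabulate (isLeast R))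
    where
      sum-tabulate : ∀ {k} (P : Fin k → Bool) → sum (tabulate (λ i → if P i then 1 else 0)) ≡ count P
      sum-tabulate {zero}  P = refl
      sum-tabulate {suc k} P = cong ((if P zero then 1 else 0) ℕ.+_) (sum-tabulate (P ∘ suc))

  isLeast-intro : (R : Fin n → Fin n → Bool) (i : Fin n) →
                  (∀ j → j Fin.< i → R i j ≡ false) → isLeast R i ≡ true
  isLeast-intro R i below = to T-≡ (all⁻ _ {filter (_<? i) (allFin n)} (All.tabulate λ {j} j∈ →
    from T-not-≡ (below j (proj₂ (∈-filter⁻ (_<? i) {xs = allFin n} j∈)))))

  isLeast-elim : (R : Fin n → Fin n → Bool) (i : Fin n) →
                 isLeast R i ≡ true → ∀ j → j Fin.< i → R i j ≡ false
  isLeast-elim R i least j j<i = to T-not-≡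
    (All.lookup (all⁺ _ _ (from T-≡ least)) (∈-filter⁺ (_<? i) (∈-allFin j) j<i))

count≤n : ∀ {n} (P : Fin n → Bool) → count P ≤ n
count≤n {zero}  P = z≤n
count≤n {suc n} P with P zero
... | true  = s≤s (count≤n (P ∘ suc))
... | false = ℕ.m≤n⇒m≤1+n (count≤n (P ∘ suc))

count-all : ∀ {n} (P : Fin n → Bool) → (∀ i → P i ≡ true) → count P ≡ n
count-all {zero}  P all = refl
count-all {suc n} P all rewrite all zero = cong suc (count-all (P ∘ suc) (all ∘ suc))

count<n : ∀ {n} (P : Fin n → Bool) {i} → P i ≡ false → count P ℕ.< n
count<n {suc n} P {zero} Pi rewrite Pi = s≤s (count≤n (P ∘ suc))
count<n {suc n} P {suc i} Pi with P zero
... | true  = s≤s (count<n (P ∘ suc) Pi)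
... | false = ℕ.m≤n⇒m≤1+n (count<n (P ∘ suc) Pi)

count≡n⇒all : ∀ {n} (P : Fin n → Bool) → count P ≡ n → ∀ i → P i ≡ true
count≡n⇒all P count≡n i with P i in Pi
... | true  = refl
... | false = ⊥-elim (ℕ.<-irrefl count≡n (count<n P Pi))

count+2≤n : ∀ {n} (P : Fin n → Bool) {i j} → i ≢ j → P i ≡ false → P j ≡ false → 2 ℕ.+ count P ≤ n
count+2≤n P {zero} {zero} i≢j _ _ = ⊥-elim (i≢j refl)
count+2≤n {suc n} P {zero} {suc j} _ Pi Pj rewrite Pi = s≤s (count<n (P ∘ suc) Pj)
count+2≤n {suc n} P {suc i} {zero} _ Pi Pj rewrite Pj = s≤s (count<n (P ∘ suc) Pi)
count+2≤n {suc n} P {suc i} {suc j} i≢j Pi Pj with P zero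
... | true  = s≤s (count+2≤n (P ∘ suc) (i≢j ∘ cong suc) Pi Pj)
... | false = ℕ.m≤n⇒m≤1+n (count+2≤n (P ∘ suc) (i≢j ∘ cong suc) Pi Pj)

n≤1+count : ∀ {n} (P : Fin n → Bool) i → (∀ k → k ≢ i → P k ≡ true) → n ≤ suc (count P)
n≤1+count {suc n} P zero others =
  s≤s (ℕ.≤-trans (ℕ.≤-reflexive (sym (count-all (P ∘ suc) (λ k → others (suc k) λ ()))))
                 (ℕ.m≤n+m _ _))
n≤1+count {suc n} P (suc i) others rewrite others zero (λ ()) =
  s≤s (n≤1+count (P ∘ suc) i (λ k k≢i → others (suc k) (k≢i ∘ suc-injective)))

module _ {n : ℕ} where
  open ≡-Reasoning

  data Position (i j k : Fin n) : Set where
    at-i      : k ≡ i → Position i j k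
    at-j      : k ≡ j → Position i j k
    elsewhere : k ≢ i → k ≢ j → Position i j k

  position : (i j k : Fin n) → Position i j k
  position i j k with k ≟ i | k ≟ j
  ... | yes k≡i | _       = at-i k≡i
  ... | no _    | yes k≡j = at-j k≡j
  ... | no k≢i  | no k≢j  = elsewhere k≢i k≢j

  transp-atˡ : (i j : Fin n) → transp i j i ≡ j
  transp-atˡ i j with i ≟ i
  ... | yes _  = refl
  ... | no i≢i = ⊥-elim (i≢i refl)

  transp-atʳ : (i j : Fin n) → transp i j j ≡ i
  transp-atʳ i j with j ≟ i
  ... | yes j≡i = j≡i
  ... | no _ with j ≟ j
  ...   | yes _  = refl
  ...   | no j≢j = ⊥-elim (j≢j refl)

  transp-fixes : ∀ {i j k : Fin n} → k ≢ i → k ≢ j → transp i j k ≡ k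
  transp-fixes {i} {j} {k} k≢i k≢j with k ≟ i
  ... | yes k≡i = ⊥-elim (k≢i k≡i)
  ... | no _ with k ≟ j
  ...   | yes k≡j = ⊥-elim (k≢j k≡j)
  ...   | no _    = refl

  transp-involutive : (i j k : Fin n) → transp i j (transp i j k) ≡ k
  transp-involutive i j k with position i j k
  ... | at-i refl = trans (cong (transp k j) (transp-atˡ k j)) (transp-atʳ k j)
  ... | at-j refl = trans (cong (transp i k) (transp-atʳ i k)) (transp-atˡ i k)
  ... | elsewhere k≢i k≢j = trans (cong (transp i j) (transp-fixes k≢i k≢j)) (transp-fixes k≢i k≢j)

  transp-sym : (i j k : Fin n) → transp i j k ≡ transp j i k
  transp-sym i j k with position i j k
  ... | at-i refl = trans (transp-atˡ k j) (sym (transp-atʳ j k))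
  ... | at-j refl = trans (transp-atʳ i k) (sym (transp-atˡ k i))
  ... | elsewhere k≢i k≢j = trans (transp-fixes k≢i k≢j) (sym (transp-fixes k≢j k≢i))

  transp-self : (i k : Fin n) → transp i i k ≡ k
  transp-self i k with position i i k
  ... | at-i refl = transp-atˡ k k
  ... | at-j refl = transp-atˡ k k
  ... | elsewhere k≢i _ = transp-fixes k≢i k≢i

  transp-braid : ∀ {i j k : Fin n} → i ≢ j → j ≢ k → i ≢ k →
                 ∀ x → transp i j (transp i k x) ≡ transp j k (transp i j x)
  transp-braid {i} {j} {k} i≢j j≢k i≢k x with position i j x
  ... | at-i refl = begin
    transp x j (transp x k x)  ≡⟨ cong (transp x j) (transp-atˡ x k) ⟩
    transp x j k               ≡⟨ transp-fixes (i≢k ∘ sym) (j≢k ∘ sym) ⟩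
    k                          ≡⟨ sym (transp-atˡ j k) ⟩
    transp j k j               ≡⟨ cong (transp j k) (sym (transp-atˡ x j)) ⟩
    transp j k (transp x j x)  ∎
  ... | at-j refl = begin
    transp i x (transp i k x)  ≡⟨ cong (transp i x) (transp-fixes (i≢j ∘ sym) j≢k) ⟩
    transp i x x               ≡⟨ transp-atʳ i x ⟩
    i                          ≡⟨ sym (transp-fixes i≢j i≢k) ⟩
    transp x k i               ≡⟨ cong (transp x k) (sym (transp-atʳ i x)) ⟩
    transp x k (transp i x x)  ∎
  ... | elsewhere x≢i x≢j with x ≟ k
  ...   | yes refl = begin
    transp i j (transp i x x)  ≡⟨ cong (transp i j) (transp-atʳ i x) ⟩
    transp i j i               ≡⟨ transp-atˡ i j ⟩
    j                          ≡⟨ sym (transp-atʳ j x) ⟩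
    transp j x x               ≡⟨ cong (transp j x) (sym (transp-fixes x≢i x≢j)) ⟩
    transp j x (transp i j x)  ∎
  ...   | no x≢k = begin
    transp i j (transp i k x)  ≡⟨ cong (transp i j) (transp-fixes x≢i x≢k) ⟩
    transp i j x               ≡⟨ transp-fixes x≢i x≢j ⟩
    x                          ≡⟨ sym (transp-fixes x≢j x≢k) ⟩
    transp j k x               ≡⟨ cong (transp j k) (sym (transp-fixes x≢i x≢j)) ⟩
    transp j k (transp i j x)  ∎

SamePair : ∀ {A : Set} → A → A → A → A → Set
SamePair x y p q = (x ≡ p × y ≡ q) ⊎ (x ≡ q × y ≡ p)

module _ {A : Set} {x y p q : A} where

  SamePair-sym : SamePair x y p q → SamePair p q x y
  SamePair-sym (inj₁ (refl , refl)) = inj₁ (refl , refl)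
  SamePair-sym (inj₂ (refl , refl)) = inj₂ (refl , refl)

  SamePair-trans : ∀ {u v} → SamePair x y p q → SamePair p q u v → SamePair x y u v
  SamePair-trans (inj₁ (refl , refl)) s = s
  SamePair-trans (inj₂ (refl , refl)) (inj₁ (refl , refl)) = inj₂ (refl , refl)
  SamePair-trans (inj₂ (refl , refl)) (inj₂ (refl , refl)) = inj₁ (refl , refl)

  SamePair-∈ : ∀ {k} → SamePair x y p q → k ≡ p ⊎ k ≡ q → k ≡ x ⊎ k ≡ y
  SamePair-∈ (inj₁ (refl , refl)) k∈ = k∈
  SamePair-∈ (inj₂ (refl , refl)) (inj₁ k≡p) = inj₂ k≡p
  SamePair-∈ (inj₂ (refl , refl)) (inj₂ k≡q) = inj₁ k≡q

  SamePair-resp : ∀ {B : Set} (f : A → B) → SamePair x y p q → f p ≡ f q → f x ≡ f y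
  SamePair-resp f (inj₁ (refl , refl)) fp≡fq = fp≡fq
  SamePair-resp f (inj₂ (refl , refl)) fp≡fq = sym fp≡fq

  SamePair-map : ∀ {B : Set} (f : A → B) → SamePair x y p q → SamePair (f x) (f y) (f p) (f q)
  SamePair-map f (inj₁ (refl , refl)) = inj₁ (refl , refl)
  SamePair-map f (inj₂ (refl , refl)) = inj₂ (refl , refl)

module Partition {n : ℕ} (R : Fin n → Fin n → Bool) (R-equiv : IsEquivB R) where
  open IsEquivB R-equiv

  Linked : Fin n → Fin n → Set
  Linked x y = x ≢ y × R x y ≡ true

  Discrete : Set
  Discrete = ∀ x y → R x y ≡ true → x ≡ y

  OneLink : Fin n → Fin n → Set
  OneLink p q = Linked p q × (∀ x y → Linked x y → SamePair x y p q)

  TwoLinks : Set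
  TwoLinks = ∃₂ λ x y → ∃₂ λ x′ y′ → Linked x y × Linked x′ y′ × ¬ SamePair x y x′ y′

  data Shape : Set where
    discrete : Discrete → Shape
    oneLink  : ∀ p q → OneLink p q → Shape
    twoLinks : TwoLinks → Shape

  shape : ExcludedMiddle 0ℓ → Shape
  shape lem with lem {∃₂ Linked}
  ... | no no-link = discrete λ x y Rxy → decidable-stable (x ≟ y) λ x≢y → no-link (x , y , x≢y , Rxy)
  ... | yes (p , q , pq) with lem {∃₂ λ x y → Linked x y × ¬ SamePair x y p q}
  ...   | yes (x , y , xy , ¬same) = twoLinks (x , y , p , q , xy , pq , ¬same)
  ...   | no no-other-link = oneLink p q (pq , λ x y xy →
            decidable-stable (lem {SamePair x y p q}) λ ¬same → no-other-link (x , y , xy , ¬same))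

  linked-sym : ∀ {x y} → Linked x y → Linked y x
  linked-sym (x≢y , Rxy) = x≢y ∘ sym , R-sym Rxy

  R-sym≡ : ∀ x y → R x y ≡ R y x
  R-sym≡ x y with R x y in Rxy | R y x in Ryx
  ... | true  | true  = refl
  ... | false | false = refl
  ... | true  | false = trans (sym (R-sym Rxy)) Ryx
  ... | false | true  = trans (sym Rxy) (R-sym Ryx)

  R-row : ∀ {x y} z → R x y ≡ true → R x z ≡ R y z
  R-row {x} {y} z Rxy with R x z in Rxz | R y z in Ryz
  ... | true  | true  = refl
  ... | false | false = refl
  ... | true  | false = trans (sym (R-trans (R-sym Rxy) Rxz)) Ryz
  ... | false | true  = trans (sym Rxz) (R-trans Rxy Ryz)

  R-cong : ∀ {x x′ y y′} → R x x′ ≡ true → R y y′ ≡ true → R x y ≡ R x′ y′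
  R-cong {x} {x′} {y} {y′} Rxx′ Ryy′ = begin
    R x y    ≡⟨ R-row y Rxx′ ⟩
    R x′ y   ≡⟨ R-sym≡ x′ y ⟩
    R y x′   ≡⟨ R-row x′ Ryy′ ⟩
    R y′ x′  ≡⟨ R-sym≡ y′ x′ ⟩
    R x′ y′  ∎
    where open ≡-Reasoning

  private
    Below : Fin n → Fin n → Set
    Below h l = l Fin.< h × R h l ≡ true

    orient : ∀ {x y} → Linked x y → ∃₂ λ h l → Below h l × SamePair x y h l
    orient {x} {y} (x≢y , Rxy) with <-cmp x y
    ... | tri< x<y _ _ = y , x , (x<y , R-sym Rxy) , inj₂ (refl , refl)
    ... | tri≈ _ x≡y _ = ⊥-elim (x≢y x≡y)
    ... | tri> _ _ y<x = x , y , (y<x , Rxy) , inj₁ (refl , refl)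

    below⇒¬least : ∀ {h l} → Below h l → isLeast R h ≡ false
    below⇒¬least {h} {l} (l<h , Rhl) with isLeast R h in least
    ... | false = refl
    ... | true  = ⊥-elim (true≢false (trans (sym Rhl) (isLeast-elim R h least l l<h)))

    below⇒linked : ∀ {h l} → Below h l → Linked h l
    below⇒linked (l<h , Rhl) = (λ { refl → ℕ.<-irrefl refl l<h }) , Rhl

    below-same-top : ∀ {h l h′ l′} → Below h l → Below h′ l′ → SamePair h l h′ l′ → h ≡ h′
    below-same-top _ _ (inj₁ (h≡h′ , _)) = h≡h′
    below-same-top (l<h , _) (l′<h′ , _) (inj₂ (refl , refl)) = ⊥-elim (ℕ.<-asym l<h l′<h′)

  discrete⇒numClasses≡n : Discrete → numClasses R ≡ n
  discrete⇒numClasses≡n disc rewrite numClasses≡count R =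
    count-all (isLeast R) λ i → isLeast-intro R i λ j j<i → not-related i j j<i
    where
      not-related : ∀ i j → j Fin.< i → R i j ≡ false
      not-related i j j<i with R i j in Rij
      ... | false = refl
      ... | true  = ⊥-elim (proj₁ (below⇒linked (j<i , Rij)) (disc i j Rij))

  numClasses≡n⇒discrete : numClasses R ≡ n → Discrete
  numClasses≡n⇒discrete nc≡n x y Rxy = decidable-stable (x ≟ y) λ x≢y →
    let (h , _ , below , _) = orient (x≢y , Rxy)
    in  true≢false (trans (sym (count≡n⇒all (isLeast R) count≡n h)) (below⇒¬least below))
    where count≡n = trans (sym (numClasses≡count R)) nc≡n

  oneLink⇒numClasses≡n∸1 : ∀ {p q} → OneLink p q → numClasses R ≡ n ∸ 1
  oneLink⇒numClasses≡n∸1 (pq , only) with orient pq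
  ... | h , l , below , pq≈hl rewrite numClasses≡count R =
    cong ℕ.pred (ℕ.≤-antisym (count<n (isLeast R) (below⇒¬least below))
                             (n≤1+count (isLeast R) h others-least))
    where
      others-least : ∀ k → k ≢ h → isLeast R k ≡ true
      others-least k k≢h = isLeast-intro R k not-related
        where
          not-related : ∀ j → j Fin.< k → R k j ≡ false
          not-related j j<k with R k j in Rkj
          ... | false = refl
          ... | true  = ⊥-elim (k≢h (below-same-top (j<k , Rkj) below
                          (SamePair-trans (only k j (below⇒linked (j<k , Rkj))) pq≈hl)))

  private
    two-non-least : ∀ {h l h′ l′} → Below h l → Below h′ l′ → h ≢ h′ → numClasses R ≤ n ∸ 2
    two-non-least below below′ h≢h′ rewrite numClasses≡count R =
      ℕ.∸-monoˡ-≤ 2 (count+2≤n (isLeast R) h≢h′ (below⇒¬least below) (below⇒¬least below′))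

    top∉ : ∀ {h l l′ h″ l″} → Below h l → Below h l′ → SamePair l l′ h″ l″ → h ≢ h″
    top∉ (l<h , _) _ (inj₁ (refl , _)) refl = ℕ.<-irrefl refl l<h
    top∉ _ (l′<h , _) (inj₂ (_ , refl)) refl = ℕ.<-irrefl refl l′<h

  twoLinks⇒numClasses≤n∸2 : TwoLinks → numClasses R ≤ n ∸ 2
  twoLinks⇒numClasses≤n∸2 (x , y , x′ , y′ , xy , x′y′ , ¬same)
    with orient xy | orient x′y′
  ... | h , l , below , xy≈hl | h′ , l′ , below′ , x′y′≈h′l′ with h ≟ h′
  ...   | no h≢h′ = two-non-least below below′ h≢h′
  ...   | yes refl with l ≟ l′
  ...     | yes refl = ⊥-elim (¬same (SamePair-trans xy≈hl (SamePair-sym x′y′≈h′l′)))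
  ...     | no l≢l′ with orient (l≢l′ , R-trans (R-sym (proj₂ below)) (proj₂ below′))
  ...       | h″ , l″ , below″ , ll′≈h″l″ = two-non-least below below″ (top∉ below below′ ll′≈h″l″)

  AllLinksThrough : Fin n → Set
  AllLinksThrough i = ∀ {x y} → Linked x y → x ≡ i ⊎ y ≡ i

  through⇒¬twoLinks : ∀ {i} → AllLinksThrough i → ¬ TwoLinks
  through⇒¬twoLinks {i} through (x , y , x′ , y′ , xy , x′y′ , ¬same)
    with spoke xy | spoke x′y′
    where
      spoke : ∀ {x y} → Linked x y → ∃ λ u → Linked i u × SamePair x y i u
      spoke {x} {y} xy with through xy
      ... | inj₁ refl = y , xy , inj₁ (refl , refl)
      ... | inj₂ refl = x , linked-sym xy , inj₂ (refl , refl)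
  ... | u , iu , xy≈iu | u′ , iu′ , x′y′≈iu′ with u ≟ u′
  ...   | yes refl = ¬same (SamePair-trans xy≈iu (SamePair-sym x′y′≈iu′))
  ...   | no u≢u′ with through (u≢u′ , R-trans (R-sym (proj₂ iu)) (proj₂ iu′))
  ...     | inj₁ u≡i  = proj₁ iu (sym u≡i)
  ...     | inj₂ u′≡i = proj₁ iu′ (sym u′≡i)

reindex-equiv : ∀ {n} {R : Fin n → Fin n → Bool} (σ : Fin n → Fin n) →
                IsEquivB R → IsEquivB (λ x y → R (σ x) (σ y))
reindex-equiv σ R-equiv = record
  { R-refl = R-refl ∘ σ ; R-sym = R-sym ; R-trans = R-trans }
  where open IsEquivB R-equiv

module PartitionReindex {n : ℕ} (R : Fin n → Fin n → Bool) (R-equiv : IsEquivB R)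
                        (σ : Fin n → Fin n) (σ-involutive : ∀ x → σ (σ x) ≡ x) where
  open Partition R R-equiv
  module σ = Partition (λ x y → R (σ x) (σ y)) (reindex-equiv σ R-equiv)

  σ-injective : ∀ {x y} → σ x ≡ σ y → x ≡ y
  σ-injective {x} {y} σx≡σy = trans (sym (σ-involutive x)) (trans (cong σ σx≡σy) (σ-involutive y))

  private
    σ-linked : ∀ {x y} → σ.Linked x y → Linked (σ x) (σ y)
    σ-linked (x≢y , Rxy) = x≢y ∘ σ-injective , Rxy

    linked-σ : ∀ {x y} → Linked x y → σ.Linked (σ x) (σ y)
    linked-σ {x} {y} (x≢y , Rxy) =
      x≢y ∘ σ-injective , trans (cong₂ R (σ-involutive x) (σ-involutive y)) Rxy

    SamePair-σ⁻¹ : ∀ {x y p q} → SamePair (σ x) (σ y) (σ p) (σ q) → SamePair x y p q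
    SamePair-σ⁻¹ (inj₁ (e₁ , e₂)) = inj₁ (σ-injective e₁ , σ-injective e₂)
    SamePair-σ⁻¹ (inj₂ (e₁ , e₂)) = inj₂ (σ-injective e₁ , σ-injective e₂)

  σ-discrete : σ.Discrete → Discrete
  σ-discrete disc x y Rxy = decidable-stable (x ≟ y) λ x≢y →
    proj₁ (linked-σ (x≢y , Rxy)) (disc (σ x) (σ y) (proj₂ (linked-σ (x≢y , Rxy))))

  σ-oneLink : ∀ {p q} → σ.OneLink p q → OneLink (σ p) (σ q)
  σ-oneLink {p} {q} (pq , only) = σ-linked pq , λ x y xy →
    SamePair-trans (SamePair-σσ x y) (SamePair-map σ (only (σ x) (σ y) (linked-σ xy)))
    where
      SamePair-σσ : ∀ x y → SamePair x y (σ (σ x)) (σ (σ y))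
      SamePair-σσ x y = inj₁ (sym (σ-involutive x) , sym (σ-involutive y))

  σ-twoLinks : σ.TwoLinks → TwoLinks
  σ-twoLinks (x , y , x′ , y′ , xy , x′y′ , ¬same) =
    σ x , σ y , σ x′ , σ y′ , σ-linked xy , σ-linked x′y′ , ¬same ∘ SamePair-σ⁻¹

module _ {n : ℕ} where
  open ≡-Reasoning

  redirect : Fin n → Fin n → Fin n → Fin n
  redirect i j k with k ≟ i
  ... | yes _ = j
  ... | no _  = k

  redirect-at : (i j : Fin n) → redirect i j i ≡ j
  redirect-at i j with i ≟ i
  ... | yes _  = refl
  ... | no i≢i = ⊥-elim (i≢i refl)

  redirect-fixes : ∀ {i j k : Fin n} → k ≢ i → redirect i j k ≡ k
  redirect-fixes {i} {j} {k} k≢i with k ≟ i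
  ... | yes k≡i = ⊥-elim (k≢i k≡i)
  ... | no _    = refl

  redirect-≢ : ∀ {i j : Fin n} → j ≢ i → ∀ k → redirect i j k ≢ i
  redirect-≢ {i} {j} j≢i k with k ≟ i
  ... | yes _  = j≢i
  ... | no k≢i = k≢i

  redirect-comm : ∀ {i j k m : Fin n} → i ≢ k → i ≢ m → j ≢ k →
                  ∀ x → redirect i j (redirect k m x) ≡ redirect k m (redirect i j x)
  redirect-comm {i} {j} {k} {m} i≢k i≢m j≢k x with position i k x
  ... | at-i refl = begin
    redirect x j (redirect k m x)  ≡⟨ cong (redirect x j) (redirect-fixes i≢k) ⟩
    redirect x j x                 ≡⟨ redirect-at x j ⟩
    j                              ≡⟨ sym (redirect-fixes j≢k) ⟩
    redirect k m j                 ≡⟨ cong (redirect k m) (sym (redirect-at x j)) ⟩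
    redirect k m (redirect x j x)  ∎
  ... | at-j refl = begin
    redirect i j (redirect x m x)  ≡⟨ cong (redirect i j) (redirect-at x m) ⟩
    redirect i j m                 ≡⟨ redirect-fixes (i≢m ∘ sym) ⟩
    m                              ≡⟨ sym (redirect-at x m) ⟩
    redirect x m x                 ≡⟨ cong (redirect x m) (sym (redirect-fixes (i≢k ∘ sym))) ⟩
    redirect x m (redirect i j x)  ∎
  ... | elsewhere x≢i x≢k = begin
    redirect i j (redirect k m x)  ≡⟨ cong (redirect i j) (redirect-fixes x≢k) ⟩
    redirect i j x                 ≡⟨ redirect-fixes x≢i ⟩
    x                              ≡⟨ sym (redirect-fixes x≢k) ⟩
    redirect k m x                 ≡⟨ cong (redirect k m) (sym (redirect-fixes x≢i)) ⟩
    redirect k m (redirect i j x)  ∎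

  transp∘redirect : ∀ {i j : Fin n} → i ≢ j → ∀ x → transp i j (redirect i j x) ≡ redirect j i x
  transp∘redirect {i} {j} i≢j x with position i j x
  ... | at-i refl = begin
    transp x j (redirect x j x)  ≡⟨ cong (transp x j) (redirect-at x j) ⟩
    transp x j j                 ≡⟨ transp-atʳ x j ⟩
    x                            ≡⟨ sym (redirect-fixes i≢j) ⟩
    redirect j x x               ∎
  ... | at-j refl = begin
    transp i x (redirect i x x)  ≡⟨ cong (transp i x) (redirect-fixes (i≢j ∘ sym)) ⟩
    transp i x x                 ≡⟨ transp-atʳ i x ⟩
    i                            ≡⟨ sym (redirect-at x i) ⟩
    redirect x i x               ∎
  ... | elsewhere x≢i x≢j = begin
    transp i j (redirect i j x)  ≡⟨ cong (transp i j) (redirect-fixes x≢i) ⟩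
    transp i j x                 ≡⟨ transp-fixes x≢i x≢j ⟩
    x                            ≡⟨ sym (redirect-fixes x≢j) ⟩
    redirect j i x               ∎

module PartitionRedirect {n : ℕ} (R : Fin n → Fin n → Bool) (R-equiv : IsEquivB R)
                         {i j : Fin n} (i≢j : i ≢ j) where
  open Partition R R-equiv
  open IsEquivB R-equiv
  module ρ = Partition (λ x y → R (redirect i j x) (redirect i j y))
                       (reindex-equiv (redirect i j) R-equiv)

  ρ-off : ∀ {x y} → x ≢ i → y ≢ i → R (redirect i j x) (redirect i j y) ≡ R x y
  ρ-off x≢i y≢i = cong₂ R (redirect-fixes x≢i) (redirect-fixes y≢i)

  ρ-ij : R (redirect i j i) (redirect i j j) ≡ true
  ρ-ij = trans (cong₂ R (redirect-at i j) (redirect-fixes (i≢j ∘ sym))) (R-refl j)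

  ρ-linked-ij : ρ.Linked i j
  ρ-linked-ij = i≢j , ρ-ij

  through⇒only-j : AllLinksThrough i → ∀ {y} → y ≢ i → R j y ≡ true → y ≡ j
  through⇒only-j through {y} y≢i Rjy = decidable-stable (y ≟ j) λ y≢j →
    [ i≢j ∘ sym , y≢i ]′ (through (y≢j ∘ sym , Rjy))

  through⇒ρ-only : AllLinksThrough i → ∀ {x y} → ρ.Linked x y → SamePair x y i j
  through⇒ρ-only through {x} {y} (x≢y , Rxy) with x ≟ i | y ≟ i
  ... | yes refl | yes refl = ⊥-elim (x≢y refl)
  ... | yes refl | no y≢i =
    inj₁ (refl , through⇒only-j through y≢i Rxy)
  ... | no x≢i | yes refl =
    inj₂ (through⇒only-j through x≢i (R-sym Rxy) , refl)
  ... | no x≢i | no y≢i with through (x≢y , Rxy)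
  ...   | inj₁ x≡i = ⊥-elim (x≢i x≡i)
  ...   | inj₂ y≡i = ⊥-elim (y≢i y≡i)

  ρ-oneLink⇒through : ∀ {p q} → ρ.OneLink p q → AllLinksThrough i
  ρ-oneLink⇒through (_ , only) {x} {y} (x≢y , Rxy) with x ≟ i | y ≟ i
  ... | yes x≡i | _       = inj₁ x≡i
  ... | no _    | yes y≡i = inj₂ y≡i
  ... | no x≢i  | no y≢i with SamePair-trans (only x y (x≢y , trans (ρ-off x≢i y≢i) Rxy))
                                             (SamePair-sym (only i j ρ-linked-ij))
  ...   | inj₁ (x≡i , _) = inj₁ x≡i
  ...   | inj₂ (_ , y≡i) = inj₂ y≡i

module Atoms (m : ℕ) (Γ : Graph) (lem : ExcludedMiddle 0ℓ) where
  open Graph Γ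

  n : ℕ
  n = 2 ℕ.+ m

  Atom : Set
  Atom = η n Γ

  Labelling : Set
  Labelling = Fin n → Maybe (V × Fin n)

  record _≃_ (a b : Atom) : Set where
    constructor mk≃
    field
      K≡ : ∀ k → K a k ≡ K b k
      R≡ : ∀ x y → R a x y ≡ R b x y

  ≃⇒≋ : ∀ {a b} → a ≃ b → _≋_ n Γ a b
  ≃⇒≋ (mk≃ K≡ R≡) = K≡ , R≡

  ≃-refl : ∀ {a} → a ≃ a
  ≃-refl = mk≃ (λ _ → refl) (λ _ _ → refl)

  ≃-sym : ∀ {a b} → a ≃ b → b ≃ a
  ≃-sym (mk≃ K≡ R≡) = mk≃ (λ k → sym (K≡ k)) (λ x y → sym (R≡ x y))

  ≃-trans : ∀ {a b c} → a ≃ b → b ≃ c → a ≃ c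
  ≃-trans (mk≃ K≡ R≡) (mk≃ K≡′ R≡′) = mk≃ (λ k → trans (K≡ k) (K≡′ k)) (λ x y → trans (R≡ x y) (R≡′ x y))

  record _≃[_]_ (a : Atom) (i : Fin n) (b : Atom) : Set where
    constructor mk≃[]
    field
      K≡ : K a i ≡ K b i
      R≡ : ∀ x y → x ≢ i → y ≢ i → R a x y ≡ R b x y

  ≡[]⇒≃[] : ∀ {a i b} → _≡[_]_ n Γ a i b → a ≃[ i ] b
  ≡[]⇒≃[] (K≡ , R≡) = mk≃[] K≡ R≡

  ≃[]⇒≡[] : ∀ {a i b} → a ≃[ i ] b → _≡[_]_ n Γ a i b
  ≃[]⇒≡[] (mk≃[] K≡ R≡) = K≡ , R≡

  ≃[]-refl : ∀ {a i} → a ≃[ i ] a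
  ≃[]-refl = mk≃[] refl (λ _ _ _ _ → refl)

  ≃[]-sym : ∀ {a b i} → a ≃[ i ] b → b ≃[ i ] a
  ≃[]-sym (mk≃[] K≡ R≡) = mk≃[] (sym K≡) (λ x y x≢i y≢i → sym (R≡ x y x≢i y≢i))

  ≃[]-trans : ∀ {a b c i} → a ≃[ i ] b → b ≃[ i ] c → a ≃[ i ] c
  ≃[]-trans (mk≃[] K≡ R≡) (mk≃[] K≡′ R≡′) =
    mk≃[] (trans K≡ K≡′) (λ x y x≢i y≢i → trans (R≡ x y x≢i y≢i) (R≡′ x y x≢i y≢i))

  -- ∼ has n classes iff it is discrete, n ∸ 1 iff it relates exactly one pair, fewer iff more.
  record Admissible (R : Fin n → Fin n → Bool) (R-equiv : IsEquivB R) (K : Labelling) : Set where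
    open Partition R R-equiv
    field
      discrete⇒total   : Discrete → ∀ k → Is-just (K k)
      oneLink⇒dom⊆     : ∀ {p q} → OneLink p q → ∀ k → Is-just (K k) → k ≡ p ⊎ k ≡ q
      oneLink⇒dom⊇     : ∀ {p q} → OneLink p q → ∀ k → k ≡ p ⊎ k ≡ q → Is-just (K k)
      oneLink⇒K≡       : ∀ {p q} → OneLink p q → K p ≡ K q
      twoLinks⇒nowhere : TwoLinks → ∀ k → K k ≡ nothing

  admissible : (a : Atom) → Admissible (R a) (R-equiv a) (K a)
  admissible a = record
    { discrete⇒total   = λ disc → proj₁ (cond-n a (discrete⇒numClasses≡n disc))
    ; oneLink⇒dom⊆     = λ pq k → proj₁ (proj₁ (cond-pair pq) k)
    ; oneLink⇒dom⊇     = λ pq k → proj₂ (proj₁ (cond-pair pq) k)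
    ; oneLink⇒K≡       = λ pq → proj₂ (cond-pair pq)
    ; twoLinks⇒nowhere = λ two → cond-n-2 a (twoLinks⇒numClasses≤n∸2 two) }
    where
      open Partition (R a) (R-equiv a)
      cond-pair : ∀ {p q} → OneLink p q →
                  (∀ k → (Is-just (K a k) → k ≡ p ⊎ k ≡ q) × (k ≡ p ⊎ k ≡ q → Is-just (K a k))) ×
                  K a p ≡ K a q
      cond-pair {p} {q} pq =
        cond-n-1 a (oneLink⇒numClasses≡n∸1 pq) p q (proj₁ (proj₁ pq)) (proj₂ (proj₁ pq))

  -- E is reflexive, so only the empty set is independent.
  defined⇒¬independent : ∀ (K : Labelling) i → Is-just (K i) → ¬ Independent (Γ ×ᴳ n) (Rng n Γ K)
  defined⇒¬independent K i Ki-just with K i in Ki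
  defined⇒¬independent K i (Any.just _) | just v = λ independent →
    independent v v (i , Ki) (i , Ki) (E-refl (proj₁ v))

  atom : (R : Fin n → Fin n → Bool) (R-equiv : IsEquivB R) (K : Labelling) →
         Admissible R R-equiv K → Atom
  atom R R-equiv K adm = record
    { K = K ; R = R ; R-equiv = R-equiv
    ; cond-n   = λ nc≡n → let total = discrete⇒total (numClasses≡n⇒discrete nc≡n)
                          in total , defined⇒¬independent K zero (total zero)
    ; cond-n-1 = cond-pair
    ; cond-n-2 = cond-small }
    where
      open Admissible adm
      open Partition R R-equiv
      cond-pair : numClasses R ≡ n ∸ 1 → ∀ i j → i ≢ j → R i j ≡ true →
                  (∀ k → (Is-just (K k) → k ≡ i ⊎ k ≡ j) × (k ≡ i ⊎ k ≡ j → Is-just (K k))) ×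
                  K i ≡ K j
      cond-pair nc≡n∸1 i j i≢j Rij with shape lem
      ... | discrete disc = ⊥-elim (ℕ.1+n≢n (trans (sym (discrete⇒numClasses≡n disc)) nc≡n∸1))
      ... | twoLinks two  = ⊥-elim (ℕ.1+n≰n (subst (_≤ m) nc≡n∸1 (twoLinks⇒numClasses≤n∸2 two)))
      ... | oneLink p q pq =
        (λ k → SamePair-∈ ij≈pq ∘ oneLink⇒dom⊆ pq k ,
               oneLink⇒dom⊇ pq k ∘ SamePair-∈ (SamePair-sym ij≈pq)) ,
        SamePair-resp K ij≈pq (oneLink⇒K≡ pq)
        where ij≈pq = proj₂ pq i j (i≢j , Rij)
      cond-small : numClasses R ≤ n ∸ 2 → ∀ k → K k ≡ nothing
      cond-small nc≤m with shape lem
      ... | discrete disc = ⊥-elim (ℕ.1+n≰n (ℕ.≤-trans (ℕ.n≤1+n _)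
                              (subst (_≤ m) (discrete⇒numClasses≡n disc) nc≤m)))
      ... | oneLink p q pq = ⊥-elim (ℕ.1+n≰n (subst (_≤ m) (oneLink⇒numClasses≡n∸1 pq) nc≤m))
      ... | twoLinks two  = twoLinks⇒nowhere two

  module _ (a : Atom) where
    open Partition (R a) (R-equiv a)
    open Admissible (admissible a)

    defined⇒through : ∀ {i} → Is-just (K a i) → AllLinksThrough i
    defined⇒through {i} Ki-just {x} {y} xy with shape lem
    ... | discrete disc  = ⊥-elim (proj₁ xy (disc x y (proj₂ xy)))
    ... | oneLink p q pq = Sum.map sym sym (SamePair-∈ (proj₂ pq x y xy) (oneLink⇒dom⊆ pq i Ki-just))
    ... | twoLinks two   = ⊥-elim (≡nothing⇒¬Is-just (twoLinks⇒nowhere two i) Ki-just)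

    through⇒defined : ∀ {i} → AllLinksThrough i → Is-just (K a i)
    through⇒defined {i} through with shape lem
    ... | discrete disc  = discrete⇒total disc i
    ... | oneLink p q pq = oneLink⇒dom⊇ pq i (Sum.map sym sym (through (proj₁ pq)))
    ... | twoLinks two   = ⊥-elim (through⇒¬twoLinks through two)

    undefined-off-link : ∀ {i x y} → Linked x y → x ≢ i → y ≢ i → K a i ≡ nothing
    undefined-off-link xy x≢i y≢i =
      ¬Is-just⇒≡nothing λ Ki-just → [ x≢i , y≢i ]′ (defined⇒through Ki-just xy)

    K-resp-R : ∀ {i j} → R a i j ≡ true → K a i ≡ K a j
    K-resp-R {i} {j} Rij with i ≟ j
    ... | yes refl = refl
    ... | no i≢j with shape lem
    ...   | discrete disc  = ⊥-elim (i≢j (disc i j Rij))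
    ...   | oneLink p q pq = SamePair-resp (K a) (proj₂ pq i j (i≢j , Rij)) (oneLink⇒K≡ pq)
    ...   | twoLinks two   = trans (twoLinks⇒nowhere two i) (sym (twoLinks⇒nowhere two j))

  reindex : (σ : Fin n → Fin n) → (∀ x → σ (σ x) ≡ x) → Atom → Atom
  reindex σ σ-involutive a =
    atom (λ x y → R a (σ x) (σ y)) (reindex-equiv σ (R-equiv a)) (K a ∘ σ) admissible-σ
    where
      open PartitionReindex (R a) (R-equiv a) σ σ-involutive
      open Admissible (admissible a)
      admissible-σ : Admissible (λ x y → R a (σ x) (σ y)) (reindex-equiv σ (R-equiv a)) (K a ∘ σ)
      admissible-σ = record
        { discrete⇒total   = λ disc k → discrete⇒total (σ-discrete disc) (σ k)
        ; oneLink⇒dom⊆     = λ pq k → Sum.map σ-injective σ-injective ∘ oneLink⇒dom⊆ (σ-oneLink pq) (σ k)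
        ; oneLink⇒dom⊇     = λ pq k → oneLink⇒dom⊇ (σ-oneLink pq) (σ k) ∘ Sum.map (cong σ) (cong σ)
        ; oneLink⇒K≡       = λ pq → oneLink⇒K≡ (σ-oneLink pq)
        ; twoLinks⇒nowhere = λ two k → twoLinks⇒nowhere (σ-twoLinks two) (σ k) }

  swap : Atom → Fin n → Fin n → Atom
  swap a i j = reindex (transp i j) (transp-involutive i j) a

  swap-≃ : ∀ {a b} i j → a ≃ b → swap a i j ≃ swap b i j
  swap-≃ i j (mk≃ K≡ R≡) = mk≃ (K≡ ∘ transp i j) (λ x y → R≡ (transp i j x) (transp i j y))

  swap-involutive : ∀ a i j → swap (swap a i j) i j ≃ a
  swap-involutive a i j = mk≃ (λ x → cong (K a) (transp-involutive i j x))
                              (λ x y → cong₂ (R a) (transp-involutive i j x) (transp-involutive i j y))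

  swap-self : ∀ a i → swap a i i ≃ a
  swap-self a i = mk≃ (λ x → cong (K a) (transp-self i x))
                      (λ x y → cong₂ (R a) (transp-self i x) (transp-self i y))

  swap-sym : ∀ a i j → swap a i j ≃ swap a j i
  swap-sym a i j = mk≃ (λ x → cong (K a) (transp-sym i j x))
                       (λ x y → cong₂ (R a) (transp-sym i j x) (transp-sym i j y))

  swap-braid : ∀ a {i j k} → i ≢ j → j ≢ k → i ≢ k → swap (swap a i j) i k ≃ swap (swap a j k) i j
  swap-braid a i≢j j≢k i≢k = mk≃ (λ x → cong (K a) (braid x)) (λ x y → cong₂ (R a) (braid x) (braid y))
    where braid = transp-braid i≢j j≢k i≢k

  R-transp-invariant : ∀ (a : Atom) {i j} → R a i j ≡ true →
                       ∀ x y → R a x y ≡ R a (transp i j x) (transp i j y)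
  R-transp-invariant a {i} {j} Rij x y = R-cong (related x) (related y)
    where
      open Partition (R a) (R-equiv a)
      open IsEquivB (R-equiv a)
      related : ∀ x → R a x (transp i j x) ≡ true
      related x with position i j x
      ... | at-i refl = subst (λ z → R a x z ≡ true) (sym (transp-atˡ x j)) Rij
      ... | at-j refl = subst (λ z → R a x z ≡ true) (sym (transp-atʳ i x)) (R-sym Rij)
      ... | elsewhere x≢i x≢j = subst (λ z → R a x z ≡ true) (sym (transp-fixes x≢i x≢j)) (R-refl x)

  ≡ᵢⱼ⇒≃swap : ∀ {a b i j} → _≡[_∣_]_ n Γ a i j b → b ≃ swap a i j
  ≡ᵢⱼ⇒≃swap {a} {b} {i} {j} (Kai≡Kbj , Kaj≡Kbi , K≡ , R≡) = mk≃ K-swap R-swap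
    where
      K-swap : ∀ x → K b x ≡ K a (transp i j x)
      K-swap x with position i j x
      ... | at-i refl = trans (sym Kaj≡Kbi) (cong (K a) (sym (transp-atˡ x j)))
      ... | at-j refl = trans (sym Kai≡Kbj) (cong (K a) (sym (transp-atʳ i x)))
      ... | elsewhere x≢i x≢j = trans (sym (K≡ x x≢i x≢j)) (cong (K a) (sym (transp-fixes x≢i x≢j)))
      R-swap : ∀ x y → R b x y ≡ R a (transp i j x) (transp i j y)
      R-swap x y = trans (R≡ x y) (if-redundant (R a i j) λ Rij → R-transp-invariant a {i} {j} Rij x y)

  ≃swap⇒≡ᵢⱼ : ∀ {a b i j} → b ≃ swap a i j → _≡[_∣_]_ n Γ a i j b
  ≃swap⇒≡ᵢⱼ {a} {b} {i} {j} (mk≃ K-swap R-swap) =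
    trans (cong (K a) (sym (transp-atʳ i j))) (sym (K-swap j)) ,
    trans (cong (K a) (sym (transp-atˡ i j))) (sym (K-swap i)) ,
    (λ k k≢i k≢j → trans (cong (K a) (sym (transp-fixes k≢i k≢j))) (sym (K-swap k))) ,
    (λ k l → trans (R-swap k l)
                   (sym (if-redundant (R a i j) λ Rij → R-transp-invariant a {i} {j} Rij k l)))

  pairLabel : Fin n → Fin n → Maybe (V × Fin n) → Labelling
  pairLabel i j v k with k ≟ i | k ≟ j
  ... | yes _ | _     = v
  ... | no _  | yes _ = v
  ... | no _  | no _  = nothing

  pairLabel-∈ : ∀ {i j v k} → k ≡ i ⊎ k ≡ j → pairLabel i j v k ≡ v
  pairLabel-∈ {i} {j} {v} {k} k∈ with k ≟ i | k ≟ j | k∈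
  ... | yes _ | _     | _ = refl
  ... | no _  | yes _ | _ = refl
  ... | no k≢i | no _  | inj₁ k≡i = ⊥-elim (k≢i k≡i)
  ... | no _  | no k≢j | inj₂ k≡j = ⊥-elim (k≢j k≡j)

  pairLabel-∉ : ∀ {i j v k} → k ≢ i → k ≢ j → pairLabel i j v k ≡ nothing
  pairLabel-∉ {i} {j} {v} {k} k≢i k≢j with k ≟ i | k ≟ j
  ... | yes k≡i | _       = ⊥-elim (k≢i k≡i)
  ... | no _    | yes k≡j = ⊥-elim (k≢j k≡j)
  ... | no _    | no _    = refl

  pairLabel-defined⇒∈ : ∀ {i j v k} → Is-just (pairLabel i j v k) → k ≡ i ⊎ k ≡ j
  pairLabel-defined⇒∈ {i} {j} {v} {k} defined with k ≟ i | k ≟ j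
  ... | yes k≡i | _       = inj₁ k≡i
  ... | no _    | yes k≡j = inj₂ k≡j
  ... | no _    | no _    = ⊥-elim (≡nothing⇒¬Is-just refl defined)

  identify : Atom → ∀ {i j} → i ≢ j → Atom
  identify c {i} {j} i≢j = atom R′ R′-equiv K′ admissible′
    where
      open PartitionRedirect (R c) (R-equiv c) i≢j
      R′ = λ x y → R c (redirect i j x) (redirect i j y)
      R′-equiv = reindex-equiv (redirect i j) (R-equiv c)
      K′ = pairLabel i j (K c i)

      ij≈ : ∀ {p q} → ρ.OneLink p q → SamePair i j p q
      ij≈ (_ , only) = only i j ρ-linked-ij

      Kci-undefined : ρ.TwoLinks → K c i ≡ nothing
      Kci-undefined (x , y , x′ , y′ , xy , x′y′ , ¬same) = ¬Is-just⇒≡nothing λ Kci-just →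
        let only-ij = through⇒ρ-only (defined⇒through c Kci-just)
        in  ¬same (SamePair-trans (only-ij xy) (SamePair-sym (only-ij x′y′)))

      admissible′ : Admissible R′ R′-equiv K′
      admissible′ = record
        { discrete⇒total   = λ disc → ⊥-elim (i≢j (disc i j ρ-ij))
        ; oneLink⇒dom⊆     = λ pq k → SamePair-∈ (SamePair-sym (ij≈ pq)) ∘ pairLabel-defined⇒∈
        ; oneLink⇒dom⊇     = λ pq k k∈ → subst Is-just (sym (pairLabel-∈ (SamePair-∈ (ij≈ pq) k∈)))
                                           (through⇒defined c (ρ-oneLink⇒through pq))
        ; oneLink⇒K≡       = λ pq → trans (pairLabel-∈ (SamePair-∈ (ij≈ pq) (inj₁ refl)))
                                          (sym (pairLabel-∈ (SamePair-∈ (ij≈ pq) (inj₂ refl))))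
        ; twoLinks⇒nowhere = λ two k → ¬Is-just⇒≡nothing λ K′k-just →
            ≡nothing⇒¬Is-just (trans (pairLabel-∈ (pairLabel-defined⇒∈ K′k-just)) (Kci-undefined two))
                              K′k-just }

  pairLabel-sym : ∀ {i j v} k → pairLabel i j v k ≡ pairLabel j i v k
  pairLabel-sym {i} {j} k with position i j k
  ... | at-i k≡i = trans (pairLabel-∈ (inj₁ k≡i)) (sym (pairLabel-∈ (inj₂ k≡i)))
  ... | at-j k≡j = trans (pairLabel-∈ (inj₂ k≡j)) (sym (pairLabel-∈ (inj₁ k≡j)))
  ... | elsewhere k≢i k≢j = trans (pairLabel-∉ k≢i k≢j) (sym (pairLabel-∉ k≢j k≢i))

  pairLabel-nothing : ∀ {i j} k → pairLabel i j nothing k ≡ nothing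
  pairLabel-nothing {i} {j} k with position i j k
  ... | at-i k≡i = pairLabel-∈ (inj₁ k≡i)
  ... | at-j k≡j = pairLabel-∈ (inj₂ k≡j)
  ... | elsewhere k≢i k≢j = pairLabel-∉ k≢i k≢j

  module _ (c : Atom) {i j : Fin n} (i≢j : i ≢ j) where

    identify-≃[] : c ≃[ i ] identify c i≢j
    identify-≃[] = mk≃[] (sym (pairLabel-∈ (inj₁ refl)))
                   λ x y x≢i y≢i → sym (cong₂ (R c) (redirect-fixes x≢i) (redirect-fixes y≢i))

    identify-links : R (identify c i≢j) i j ≡ true
    identify-links = PartitionRedirect.ρ-ij (R c) (R-equiv c) i≢j

    identify-unique : ∀ {a} → a ≃[ i ] c → R a i j ≡ true → a ≃ identify c i≢j
    identify-unique {a} (mk≃[] Kai≡Kci R≡) Rij = mk≃ K≡ R≡′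
      where
        open Partition (R a) (R-equiv a)
        K≡ : ∀ x → K a x ≡ pairLabel i j (K c i) x
        K≡ x with position i j x
        ... | at-i refl = trans Kai≡Kci (sym (pairLabel-∈ (inj₁ refl)))
        ... | at-j refl = trans (sym (K-resp-R a Rij)) (trans Kai≡Kci (sym (pairLabel-∈ (inj₂ refl))))
        ... | elsewhere x≢i x≢j =
          trans (undefined-off-link a (i≢j , Rij) (x≢i ∘ sym) (x≢j ∘ sym)) (sym (pairLabel-∉ x≢i x≢j))
        related : ∀ x → R a x (redirect i j x) ≡ true
        related x with x ≟ i
        ... | yes refl = Rij
        ... | no _     = IsEquivB.R-refl (R-equiv a) x
        R≡′ : ∀ x y → R a x y ≡ R c (redirect i j x) (redirect i j y)
        R≡′ x y = trans (R-cong (related x) (related y))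
                        (R≡ _ _ (redirect-≢ (i≢j ∘ sym) x) (redirect-≢ (i≢j ∘ sym) y))

  identify-keeps-link : ∀ b {i j} (i≢j : i ≢ j) x → R b x j ≡ true → R (identify b i≢j) x j ≡ true
  identify-keeps-link b {i} {j} i≢j x Rxj = go (x ≟ i)
    where
      go : Dec (x ≡ i) → R (identify b i≢j) x j ≡ true
      go (yes refl) = identify-links b i≢j
      go (no x≢i)   = trans (sym (_≃[_]_.R≡ (identify-≃[] b i≢j) x j x≢i (i≢j ∘ sym))) Rxj

  identify-resp-≃[] : ∀ {a c i j} (i≢j : i ≢ j) → a ≃[ i ] c → identify a i≢j ≃ identify c i≢j
  identify-resp-≃[] {a} {c} i≢j a≃c =
    identify-unique c i≢j (≃[]-trans (≃[]-sym (identify-≃[] a i≢j)) a≃c) (identify-links a i≢j)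

  identify-comm : ∀ {e : Atom} {i j k m} (i≢j : i ≢ j) (k≢m : k ≢ m) → i ≢ k → i ≢ m → j ≢ k →
                  identify (identify e i≢j) k≢m ≃ identify (identify e k≢m) i≢j
  identify-comm {e} {i} {j} {k} {m} i≢j k≢m i≢k i≢m j≢k = mk≃ K≡ R≡
    where
      K≡ : ∀ x → pairLabel k m (pairLabel i j (K e i) k) x ≡ pairLabel i j (pairLabel k m (K e k) i) x
      K≡ x = begin
        pairLabel k m (pairLabel i j (K e i) k) x
          ≡⟨ cong (λ v → pairLabel k m v x) (pairLabel-∉ (i≢k ∘ sym) (j≢k ∘ sym)) ⟩
        pairLabel k m nothing x                    ≡⟨ pairLabel-nothing x ⟩
        nothing                                    ≡⟨ sym (pairLabel-nothing x) ⟩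
        pairLabel i j nothing x
          ≡⟨ cong (λ v → pairLabel i j v x) (sym (pairLabel-∉ i≢k i≢m)) ⟩
        pairLabel i j (pairLabel k m (K e k) i) x  ∎
        where open ≡-Reasoning
      R≡ : ∀ x y → R e (redirect i j (redirect k m x)) (redirect i j (redirect k m y)) ≡
                   R e (redirect k m (redirect i j x)) (redirect k m (redirect i j y))
      R≡ x y = cong₂ (R e) (redirect-comm i≢k i≢m j≢k x) (redirect-comm i≢k i≢m j≢k y)

  identify-swap : ∀ {e : Atom} {i j} (i≢j : i ≢ j) → identify (swap e i j) i≢j ≃ identify e (i≢j ∘ sym)
  identify-swap {e} {i} {j} i≢j = mk≃
    (λ x → trans (cong (λ v → pairLabel i j v x) (cong (K e) (transp-atˡ i j))) (pairLabel-sym x))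
    (λ x y → cong₂ (R e) (transp∘redirect i≢j x) (transp∘redirect i≢j y))

module Algebra (m : ℕ) (Γ : Graph) (lem : ExcludedMiddle 0ℓ) where
  open Atoms m Γ lem
  open PEASig (𝔅 n Γ)

  Element : Set₁
  Element = Sub n Γ

  _≈_ : Element → Element → Set
  _≈_ = _≈𝔅_ n Γ

  _⊆_ : Element → Element → Set
  X ⊆ Y = ∀ a → X ∋ a → Y ∋ a

  -- Stated for membership predicates: an element's ∋-resp field is never determined by
  -- unification, so these lemmas could not infer their Element arguments.
  ⊆-antisym : ∀ {P Q : Pred Atom 0ℓ} → (∀ a → P a → Q a) → (∀ a → Q a → P a) →
              ∀ a → (P a → Q a) × (Q a → P a)
  ⊆-antisym P⊆Q Q⊆P a = P⊆Q a , Q⊆P a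

  ⊆⇒≤ᴮ : ∀ {P Q : Pred Atom 0ℓ} → (∀ a → P a → Q a) → ∀ a → (P a × Q a → P a) × (P a → P a × Q a)
  ⊆⇒≤ᴮ P⊆Q a = proj₁ , λ x → x , P⊆Q a x

  ≈-isEquivalence : IsEquivalence _≈_
  ≈-isEquivalence = record
    { refl  = λ a → id , id
    ; sym   = λ X≈Y a → proj₂ (X≈Y a) , proj₁ (X≈Y a)
    ; trans = λ X≈Y Y≈Z a → proj₁ (Y≈Z a) ∘ proj₁ (X≈Y a) , proj₂ (X≈Y a) ∘ proj₂ (Y≈Z a) }

  ≐⇒≈ : ∀ {P Q : Pred Atom 0ℓ} → P ≐ Q → ∀ a → (P a → Q a) × (Q a → P a)
  ≐⇒≈ (P⊆Q , Q⊆P) a = P⊆Q , Q⊆P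

  ≈⇒≐ : ∀ {P Q : Pred Atom 0ℓ} → (∀ a → (P a → Q a) × (Q a → P a)) → P ≐ Q
  ≈⇒≐ P≈Q = proj₁ (P≈Q _) , proj₂ (P≈Q _)

  isBooleanAlgebra : IsBooleanAlgebra _≈_ _+_ _·_ -_ 𝟙 𝟘
  isBooleanAlgebra = record
    { isDistributiveLattice = record
      { isLattice = record
        { isEquivalence = ≈-isEquivalence
        ; ∨-comm     = λ X Y → ≐⇒≈ (Pred.∪-comm (X ∋_) (Y ∋_))
        ; ∨-assoc    = λ X Y Z → ≐⇒≈ (Pred.∪-assoc (X ∋_) (Y ∋_) (Z ∋_))
        ; ∨-cong     = λ X≈Y U≈V → ≐⇒≈ (Pred.∪-cong (≈⇒≐ X≈Y) (≈⇒≐ U≈V))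
        ; ∧-comm     = λ X Y → ≐⇒≈ (Pred.∩-comm (X ∋_) (Y ∋_))
        ; ∧-assoc    = λ X Y Z → ≐⇒≈ (Pred.∩-assoc (X ∋_) (Y ∋_) (Z ∋_))
        ; ∧-cong     = λ X≈Y U≈V → ≐⇒≈ (Pred.∩-cong (≈⇒≐ X≈Y) (≈⇒≐ U≈V))
        ; absorptive = (λ X Y → ≐⇒≈ (Pred.∪-abs-∩ (X ∋_) (Y ∋_))) ,
                       (λ X Y → ≐⇒≈ (Pred.∩-abs-∪ (X ∋_) (Y ∋_))) }
      ; ∨-distrib-∧ = (λ X Y Z → ≐⇒≈ (Pred.∪-distribˡ-∩ (X ∋_) (Y ∋_) (Z ∋_))) ,
                      (λ X Y Z → ≐⇒≈ (Pred.∪-distribʳ-∩ (X ∋_) (Y ∋_) (Z ∋_)))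
      ; ∧-distrib-∨ = (λ X Y Z → ≐⇒≈ (Pred.∩-distribˡ-∪ (X ∋_) (Y ∋_) (Z ∋_))) ,
                      (λ X Y Z → ≐⇒≈ (Pred.∩-distribʳ-∪ (X ∋_) (Y ∋_) (Z ∋_))) }
    ; ∨-complement = (λ X a → (λ _ → tt) , (λ _ → Sum.swap (excluded-middle X a))) ,
                     (λ X a → (λ _ → tt) , (λ _ → excluded-middle X a))
    ; ∧-complement = (λ X a → (λ (∉X , ∈X) → ∉X ∈X) , λ ()) ,
                     (λ X a → (λ (∈X , ∉X) → ∉X ∈X) , λ ())
    ; ¬-cong = λ X≈Y a → (λ ∉X → ∉X ∘ proj₂ (X≈Y a)) , (λ ∉Y → ∉Y ∘ proj₁ (X≈Y a)) }
    where
      excluded-middle : ∀ X a → X ∋ a ⊎ ¬ (X ∋ a)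
      excluded-middle X a with lem {X ∋ a}
      ... | yes ∈X = inj₁ ∈X
      ... | no ∉X  = inj₂ ∉X

  ∋-resp-≃ : ∀ X {a b} → a ≃ b → X ∋ a ⇔ X ∋ b
  ∋-resp-≃ X a≃b = mk⇔ (∋-resp X (≃⇒≋ a≃b)) (∋-resp X (≃⇒≋ (≃-sym a≃b)))

  ⇔⇒≈ : ∀ {P Q : Pred Atom 0ℓ} → (∀ a → P a ⇔ Q a) → ∀ a → (P a → Q a) × (Q a → P a)
  ⇔⇒≈ P⇔Q a = to (P⇔Q a) , from (P⇔Q a)

  record Preimage (F : Element → Element) (φ : Atom → Atom) : Set₁ where
    constructor mkPreimage
    field ∈⇔ : ∀ X a → F X ∋ a ⇔ X ∋ φ a
  open Preimage

  preimage-∘ : ∀ {F G φ ψ} → Preimage F φ → Preimage G ψ → Preimage (F ∘ G) (ψ ∘ φ)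
  preimage-∘ {G = G} {φ} F-pre G-pre = mkPreimage λ X a → ⇔.trans (∈⇔ F-pre (G X) a) (∈⇔ G-pre X (φ a))

  preimage-≈ : ∀ {F G φ ψ} → Preimage F φ → Preimage G ψ → (∀ a → φ a ≃ ψ a) → ∀ X → F X ≈ G X
  preimage-≈ F-pre G-pre φ≃ψ X = ⇔⇒≈ λ a →
    ⇔.trans (∈⇔ F-pre X a) (⇔.trans (∋-resp-≃ X (φ≃ψ a)) (⇔.sym (∈⇔ G-pre X a)))

  preimage-id : Preimage id id
  preimage-id = mkPreimage λ X a → ⇔.refl

  preimage-cong : ∀ {F φ} → Preimage F φ → ∀ {X Y} → X ≈ Y → F X ≈ F Y
  preimage-cong {φ = φ} F-pre {X} {Y} X≈Y = ⇔⇒≈ λ a →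
    ⇔.trans (∈⇔ F-pre X a) (⇔.trans (mk⇔ (proj₁ (X≈Y (φ a))) (proj₂ (X≈Y (φ a)))) (⇔.sym (∈⇔ F-pre Y a)))

  preimage-isBoolEndo : ∀ {F φ} → Preimage F φ → IsBoolEndo _≈_ (𝔅 n Γ) F
  preimage-isBoolEndo pre = record
    { pres-+ = λ X Y → ⇔⇒≈ λ a → ⇔.trans (∈⇔ pre (X + Y) a)
                 (mk⇔ (Sum.map (from (∈⇔ pre X a)) (from (∈⇔ pre Y a)))
                      (Sum.map (to (∈⇔ pre X a)) (to (∈⇔ pre Y a))))
    ; pres-· = λ X Y → ⇔⇒≈ λ a → ⇔.trans (∈⇔ pre (X · Y) a)
                 (mk⇔ (λ (∈X , ∈Y) → from (∈⇔ pre X a) ∈X , from (∈⇔ pre Y a) ∈Y)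
                      (λ (∈FX , ∈FY) → to (∈⇔ pre X a) ∈FX , to (∈⇔ pre Y a) ∈FY))
    ; pres-- = λ X → ⇔⇒≈ λ a → ⇔.trans (∈⇔ pre (- X) a)
                 (mk⇔ (λ ∉X → ∉X ∘ to (∈⇔ pre X a)) (λ ∉FX → ∉FX ∘ from (∈⇔ pre X a)))
    ; pres-𝟘 = ⇔⇒≈ λ a → ⇔.trans (∈⇔ pre 𝟘 a) (mk⇔ (λ ()) (λ ()))
    ; pres-𝟙 = ⇔⇒≈ λ a → ⇔.trans (∈⇔ pre 𝟙 a) (mk⇔ (λ _ → tt) (λ _ → tt)) }

  s-preimage : ∀ i j → Preimage (s i j) (λ a → swap a i j)
  s-preimage i j = mkPreimage λ X a → mk⇔
    (λ (b , ∈X , b≡a) → to (∋-resp-≃ X (swap-swap {a} b≡a)) ∈X)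
    (λ ∈X → swap a i j , ∈X , ≃swap⇒≡ᵢⱼ {swap a i j} (≃-sym (swap-involutive a i j)))
    where
      swap-swap : ∀ {a b} → _≡[_∣_]_ n Γ b i j a → b ≃ swap a i j
      swap-swap {a} {b} b≡a =
        ≃-sym (≃-trans (swap-≃ i j (≡ᵢⱼ⇒≃swap {b} {a} b≡a)) (swap-involutive b i j))

  cd-preimage : ∀ {i j} (i≢j : i ≢ j) → Preimage (λ X → c i (X · d i j)) (λ a → identify a i≢j)
  cd-preimage i≢j = mkPreimage λ X a → mk⇔
    (λ (b , (∈X , Rij) , b≡a) → to (∋-resp-≃ X (identify-unique a i≢j (≡[]⇒≃[] b≡a) Rij)) ∈X)
    (λ ∈X → identify a i≢j , (∈X , identify-links a i≢j) , ≃[]⇒≡[] (≃[]-sym (identify-≃[] a i≢j)))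

  sub-preimage : ∀ {i j} (i≢j : i ≢ j) → Preimage s[ i / j ] (λ a → identify a i≢j)
  sub-preimage {i} {j} i≢j = mkPreimage go
    where
      go : ∀ X a → s[ i / j ] X ∋ a ⇔ X ∋ identify a i≢j
      go X a with i ≟ j
      ... | yes i≡j = ⊥-elim (i≢j i≡j)
      ... | no _    = ∈⇔ (cd-preimage i≢j) X a

  sub-refl-preimage : ∀ i → Preimage s[ i / i ] id
  sub-refl-preimage i = mkPreimage go
    where
      go : ∀ X a → s[ i / i ] X ∋ a ⇔ X ∋ a
      go X a with i ≟ i
      ... | yes _  = ⇔.refl
      ... | no i≢i = ⊥-elim (i≢i refl)

  c-mono : ∀ i {X Y} → X ⊆ Y → c i X ⊆ c i Y
  c-mono i X⊆Y a (b , ∈X , b≡a) = b , X⊆Y b ∈X , b≡a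

  c-extensive : ∀ i X → X ⊆ c i X
  c-extensive i X a ∈X = a , ∈X , ≃[]⇒≡[] (≃[]-refl {a} {i})

  c-saturated : ∀ i X {a b} → a ≃[ i ] b → c i X ∋ a → c i X ∋ b
  c-saturated i X a≃b (a′ , ∈X , a′≡a) = a′ , ∈X , ≃[]⇒≡[] (≃[]-trans (≡[]⇒≃[] {a′} a′≡a) a≃b)

  c-+ : ∀ i X Y → c i (X + Y) ≈ (c i X + c i Y)
  c-+ i X Y = ⊆-antisym
    (λ { a (b , inj₁ ∈X , b≡a) → inj₁ (b , ∈X , b≡a) ; a (b , inj₂ ∈Y , b≡a) → inj₂ (b , ∈Y , b≡a) })
    (λ { a (inj₁ ∈cX) → c-mono i {X} {X + Y} (λ _ → inj₁) a ∈cX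
       ; a (inj₂ ∈cY) → c-mono i {Y} {X + Y} (λ _ → inj₂) a ∈cY })

  sub-cong : ∀ i j {X Y} → X ≈ Y → s[ i / j ] X ≈ s[ i / j ] Y
  sub-cong i j {X} {Y} X≈Y with i ≟ j
  ... | yes refl = X≈Y
  ... | no i≢j   = preimage-cong (cd-preimage i≢j) {X} {Y} X≈Y

  sub-c : ∀ i j X → s[ i / j ] (c i X) ≈ c i X
  sub-c i j X with i ≟ j
  ... | yes refl = λ a → id , id
  ... | no i≢j   = ⇔⇒≈ λ a → ⇔.trans (∈⇔ (cd-preimage i≢j) (c i X) a)
      (mk⇔ (c-saturated i X (≃[]-sym (identify-≃[] a i≢j))) (c-saturated i X (identify-≃[] a i≢j)))

  c-sub : ∀ i j X → i ≢ j → c i (s[ i / j ] X) ≈ s[ i / j ] X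
  c-sub i j X i≢j with i ≟ j
  ... | yes i≡j = ⊥-elim (i≢j i≡j)
  ... | no _    = ⊆-antisym
      (λ a (b , ∈sub , b≡a) → from (∈⇔ (cd-preimage i≢j) X a)
         (to (∋-resp-≃ X (identify-resp-≃[] i≢j (≡[]⇒≃[] b≡a))) (to (∈⇔ (cd-preimage i≢j) X b) ∈sub)))
      (c-extensive i (c i (X · d i j)))

  sub-comm : ∀ i j k m X → i ≢ k → i ≢ m → j ≢ k → j ≢ m →
             s[ i / j ] (s[ k / m ] X) ≈ s[ k / m ] (s[ i / j ] X)
  sub-comm i j k m X i≢k i≢m j≢k _ with i ≟ j | k ≟ m
  ... | yes refl | _        = λ a → id , id
  ... | no _     | yes refl = λ a → id , id
  ... | no i≢j   | no k≢m   =
    preimage-≈ (preimage-∘ (cd-preimage i≢j) (cd-preimage k≢m))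
               (preimage-∘ (cd-preimage k≢m) (cd-preimage i≢j))
               (λ a → identify-comm {a} i≢j k≢m i≢k i≢m j≢k) X

  sub-isBoolEndo : ∀ i j → IsBoolEndo _≈_ (𝔅 n Γ) s[ i / j ]
  sub-isBoolEndo i j with i ≟ j
  ... | yes refl = preimage-isBoolEndo preimage-id
  ... | no i≢j   = preimage-isBoolEndo (cd-preimage i≢j)

  s-sub : ∀ i j X → s i j (s[ i / j ] X) ≈ s[ j / i ] X
  s-sub i j X with i ≟ j
  ... | yes refl = preimage-≈ (s-preimage i i) (sub-refl-preimage i) (λ a → swap-self a i) X
  ... | no i≢j   = preimage-≈ (preimage-∘ (s-preimage i j) (cd-preimage i≢j))
                              (sub-preimage (i≢j ∘ sym)) (λ a → identify-swap i≢j) X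

  sub-d : ∀ i j → s[ i / j ] (d i j) ≈ 𝟙
  sub-d i j with i ≟ j
  ... | yes refl = λ a → (λ _ → tt) , (λ _ → IsEquivB.R-refl (R-equiv a) i)
  ... | no i≢j   = ⇔⇒≈ λ a → ⇔.trans (∈⇔ (cd-preimage i≢j) (d i j) a)
                                      (mk⇔ (λ _ → tt) (λ _ → identify-links a i≢j))

  d-sub : ∀ i j X → (X · d i j) ⊆ s[ i / j ] X
  d-sub i j X with i ≟ j
  ... | yes refl = λ a → proj₁
  ... | no i≢j   = λ a (∈X , Rij) → from (∈⇔ (cd-preimage i≢j) X a)
                                         (to (∋-resp-≃ X (identify-unique a i≢j ≃[]-refl Rij)) ∈X)

  isPEA : IsPEA _≈_ (𝔅 n Γ)
  isPEA = record
    { isBooleanAlgebra = isBooleanAlgebra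
    ; c-cong   = λ i {X} {Y} X≈Y →
                   ⊆-antisym (c-mono i {X} {Y} (proj₁ ∘ X≈Y)) (c-mono i {Y} {X} (proj₂ ∘ X≈Y))
    ; sub-cong = sub-cong
    ; s-cong   = λ i j {X} {Y} → preimage-cong (s-preimage i j) {X} {Y}
    ; d-ii     = λ i a → (λ _ → tt) , (λ _ → IsEquivB.R-refl (R-equiv a) i)
    ; sub-ii   = λ i → preimage-≈ (sub-refl-preimage i) preimage-id (λ _ → ≃-refl)
    ; s-ii     = λ i → preimage-≈ (s-preimage i i) preimage-id (λ a → swap-self a i)
    ; s-comm   = λ i j → preimage-≈ (s-preimage i j) (s-preimage j i) (λ a → swap-sym a i j)
    ; Q1  = λ i X → ⊆⇒≤ᴮ (c-extensive i X)
    ; Q2  = c-+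
    ; Q3  = sub-c
    ; Q4  = c-sub
    ; Q5  = sub-comm
    ; Q6-sub = sub-isBoolEndo
    ; Q6-s   = λ i j → preimage-isBoolEndo (s-preimage i j)
    ; Q7  = λ i j → preimage-≈ (preimage-∘ (s-preimage i j) (s-preimage i j)) preimage-id
                               (λ a → swap-involutive a i j)
    ; Q8  = λ i j k X i≢j j≢k i≢k →
              preimage-≈ (preimage-∘ (s-preimage i j) (s-preimage i k))
                         (preimage-∘ (s-preimage j k) (s-preimage i j))
                         (λ a → swap-braid a i≢j j≢k i≢k) X
    ; Q9  = s-sub
    ; Q10 = sub-d
    ; Q11 = λ i j X → ⊆⇒≤ᴮ (d-sub i j X) }

module Simplicity (m : ℕ) (Γ : Graph) (lem₀ : ExcludedMiddle 0ℓ) (lem₁ : ExcludedMiddle (lsuc 0ℓ)) where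
  open Atoms (suc m) Γ lem₀
  open Algebra (suc m) Γ lem₀
  open PEASig (𝔅 n Γ)

  data Path : List (Fin n) → Atom → Atom → Set where
    []  : ∀ {a} → Path [] a a
    _∷_ : ∀ {i l a b c} → a ≃[ i ] b → Path l b c → Path (i ∷ l) a c

  _++ᵖ_ : ∀ {l l′ a b c} → Path l a b → Path l′ b c → Path (l ++ l′) a c
  []       ++ᵖ q = q
  (e ∷ p) ++ᵖ q = e ∷ (p ++ᵖ q)

  reverseᵖ : ∀ {l a b} → Path l a b → Path (reverse l) b a
  reverseᵖ [] = []
  reverseᵖ {i ∷ l} (e ∷ p) rewrite unfold-reverse i l = reverseᵖ p ++ᵖ (≃[]-sym e ∷ [])

  cylindrify : List (Fin n) → Element → Element
  cylindrify []      X = X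
  cylindrify (i ∷ l) X = cylindrify l (c i X)

  path-∈ : ∀ {l a b} X → Path l a b → X ∋ a → cylindrify l X ∋ b
  path-∈ X []                         ∈X = ∈X
  path-∈ X (_∷_ {i = i} {a = a} e p) ∈X = path-∈ (c i X) p (a , ∈X , ≃[]⇒≡[] e)

  cylindrify-ideal : ∀ {I} → IsIdeal _≈_ (𝔅 n Γ) I → ∀ l {X} → I X → I (cylindrify l X)
  cylindrify-ideal ideal []      ∈I = ∈I
  cylindrify-ideal ideal (i ∷ l) ∈I = cylindrify-ideal ideal l (IsIdeal.c-closed ideal i ∈I)

  record Collapsed (z : Atom) : Set where
    constructor collapsed
    field related : ∀ x y → R z x y ≡ true
  open Collapsed

  link-to-zero : ∀ l → All (_≢ zero) l → ∀ b →
                 ∃ λ z → Path l b z × (∀ k → R b k zero ≡ true ⊎ k ∈ l → R z k zero ≡ true)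
  link-to-zero []      _             b = b , [] , λ { k (inj₁ Rk0) → Rk0 ; k (inj₂ ()) }
  link-to-zero (k ∷ l) (k≢0 ∷ l≢0) b with link-to-zero l l≢0 (identify b k≢0)
  ... | z , p , linked = z , identify-≃[] b k≢0 ∷ p , λ k′ → linked k′ ∘ step k′
    where
      step : ∀ k′ → R b k′ zero ≡ true ⊎ k′ ∈ k ∷ l → R (identify b k≢0) k′ zero ≡ true ⊎ k′ ∈ l
      step k′ (inj₂ (there k′∈l)) = inj₂ k′∈l
      step k′ (inj₂ (here refl))  = inj₁ (identify-links b k≢0)
      step k′ (inj₁ Rk′0)         = inj₁ (identify-keeps-link b k≢0 k′ Rk′0)

  nonzero : List (Fin n)
  nonzero = tabulate suc

  path-to-collapsed : ∀ a → ∃ λ z → Path nonzero a z × Collapsed z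
  path-to-collapsed a with link-to-zero nonzero (tabulate⁺ {f = suc} λ _ ()) a
  ... | z , p , linked = z , p , collapsed λ x y → R-trans (to-zero x) (R-sym (to-zero y))
    where
      open IsEquivB (R-equiv z)
      to-zero : ∀ k → R z k zero ≡ true
      to-zero zero    = linked zero (inj₁ (IsEquivB.R-refl (R-equiv a) zero))
      to-zero (suc k) = linked (suc k) (inj₂ (∈-tabulate⁺ {f = suc} k))

  collapsed-unique : ∀ {z z′} → Collapsed z → Collapsed z′ → z ≃ z′
  collapsed-unique cz cz′ = mk≃ (λ k → trans (nowhere cz k) (sym (nowhere cz′ k)))
                                         (λ x y → trans (related cz x y) (sym (related cz′ x y)))
    where
      nowhere : ∀ {z} → Collapsed z → ∀ k → K z k ≡ nothing
      nowhere {z} cz = Admissible.twoLinks⇒nowhere (admissible z)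
        (zero , suc zero , zero , suc (suc zero) ,
         ((λ ()) , related cz _ _) , ((λ ()) , related cz _ _) , λ { (inj₁ (_ , ())) ; (inj₂ (() , _)) })

  isSimple : IsSimple _≈_ (𝔅 n Γ)
  isSimple I ideal with lem₁ {∃ λ X → I X × ¬ (X ≈ 𝟘)}
  ... | no no-nonzero = inj₁ λ X ∈I → decidable-stable (lem₀ {X ≈ 𝟘}) λ X≉𝟘 → no-nonzero (X , ∈I , X≉𝟘)
  ... | yes (X , ∈I , X≉𝟘) with lem₀ {∃ (X ∋_)}
  ...   | no empty = ⊥-elim (X≉𝟘 λ a → (λ ∈X → empty (a , ∈X)) , λ ())
  ...   | yes (a , ∈X) = inj₂ λ Y → IsIdeal.↓-closed ideal Y₀∈I (⊆⇒≤ᴮ λ b _ → everything-in-Y₀ b)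
    where
      Y₀ = cylindrify (reverse nonzero) (cylindrify nonzero X)
      Y₀∈I : I Y₀
      Y₀∈I = cylindrify-ideal ideal (reverse nonzero) (cylindrify-ideal ideal nonzero ∈I)
      everything-in-Y₀ : ∀ b → Y₀ ∋ b
      everything-in-Y₀ b with path-to-collapsed a | path-to-collapsed b
      ... | z , a→z , cz | z′ , b→z′ , cz′ =
        path-∈ (cylindrify nonzero X) (reverseᵖ b→z′)
               (∋-resp (cylindrify nonzero X) (≃⇒≋ (collapsed-unique cz cz′)) (path-∈ X a→z ∈X))

mainTheorem8 : (lem : ∀ {ℓ} → ExcludedMiddle ℓ) →
               (n : ℕ) → 2 < n → (Γ : Graph) →
               IsPEA (_≈𝔅_ n Γ) (𝔅 n Γ) × IsSimple (_≈𝔅_ n Γ) (𝔅 n Γ)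
mainTheorem8 lem (suc (suc (suc m))) (s≤s (s≤s (s≤s _))) Γ =
  Algebra.isPEA (suc m) Γ lem , Simplicity.isSimple m Γ lem lem
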